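{- Let $N$ be a network. The following are equivalent: (i) $N$ is arboreal; (ii) $\tilde h(N)=r(N)-1$; (iii) $N$ contains no $k$-alternating cycle for any $k\ge1$.
   Context: In a digraph, a leaf is a vertex of indegree 1 and outdegree 0, a root is a vertex of indegree 0. A network (on a finite set $X$, $|X|\ge2$) is a simple acyclic digraph $N$ whose underlying undirected graph is connected, whose set of leaves is $X$, in which every vertex of indegree 0 has outdegree at least 2, every vertex of outdegree 0 has indegree 1, and no vertex has both indegree and outdegree equal to 1. $N$ is arboreal if its underlying undirected graph is a tree. $r(N)$ is the number of roots. A hybrid vertex is a vertex of indegree at least 2; $\tilde h(N)=\sum_{h}(\mathrm{indeg}(h)-1)$ over hybrid vertices $h$ (0 if there are none). A $k$-alternating cycle ($k\ge1$) is a sequence $v_1,h_1,v_2,h_2,\dots,v_k,h_k$ of vertices such that for each $i$, $h_i$ is a hybrid vertex and there exist internally vertex-disjoint directed paths from $v_i$ to $h_i$ and from $v_{i+1}$ to $h_i$, where $v_{k+1}=v_1$. -}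

module Defs where

open import Data.Nat using (ℕ; zero; suc; _+_; _∸_; _≤_; _≡ᵇ_)
open import Data.Nat.DivMod using (_mod_)
open import Data.Fin using (Fin; zero; suc; toℕ)
open import Data.Bool using (Bool; true; false; if_then_else_; _∧_)
open import Data.List using (List; []; _∷_; _++_; length)
open import Data.List.Membership.Propositional using (_∈_; _∉_)
open import Data.List.Relation.Unary.Unique.Propositional using (Unique)
open import Data.List.Relation.Unary.Linked using (Linked)
open import Data.Product using (Σ; _×_; ∃)
open import Data.Sum using (_⊎_)
open import Relation.Binary.PropositionalEquality using (_≡_; _≢_)
open import Relation.Binary.Construct.Closure.ReflexiveTransitive using (Star)
open import Relation.Nullary using (¬_)
open import Function using (_∘_)
open import Function.Definitions using (Injective)

-- A finite simple digraph on vertex set Fin n, given by its adjacency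
-- relation (a Bool matrix, so there are no multiple edges).
record Digraph : Set where
  field
    n   : ℕ
    adj : Fin n → Fin n → Bool
open Digraph public

count : ∀ {n} → (Fin n → Bool) → ℕ
count {zero}  f = 0
count {suc n} f = (if f zero then 1 else 0) + count (f ∘ suc)

sumFin : ∀ {n} → (Fin n → ℕ) → ℕ
sumFin {zero}  f = 0
sumFin {suc n} f = f zero + sumFin (f ∘ suc)

module _ (G : Digraph) where

  Vtx : Set
  Vtx = Fin (n G)

  Edge : Vtx → Vtx → Set
  Edge u v = adj G u v ≡ true

  indeg : Vtx → ℕ
  indeg v = count (λ u → adj G u v)

  outdeg : Vtx → ℕ
  outdeg v = count (λ w → adj G v w)

  isLeaf : Vtx → Bool
  isLeaf v = (indeg v ≡ᵇ 1) ∧ (outdeg v ≡ᵇ 0)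

  isRoot : Vtx → Bool
  isRoot v = indeg v ≡ᵇ 0

  numLeaves : ℕ
  numLeaves = count isLeaf

  r : ℕ
  r = count isRoot

  -- h̃(N) = Σ over hybrids h of (indeg h - 1); vertices of indegree ≤ 1 contribute 0
  h̃ : ℕ
  h̃ = sumFin (λ v → indeg v ∸ 1)

  Hybrid : Vtx → Set
  Hybrid v = 2 ≤ indeg v

  data Reach⁺ : Vtx → Vtx → Set where
    [_] : ∀ {u v} → Edge u v → Reach⁺ u v
    _∷_ : ∀ {u v w} → Edge u v → Reach⁺ v w → Reach⁺ u w

  Acyclic : Set
  Acyclic = ∀ v → ¬ Reach⁺ v v

  Loopless : Set
  Loopless = ∀ v → ¬ Edge v v

  UAdj : Vtx → Vtx → Set
  UAdj u v = Edge u v ⊎ Edge v u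

  Connected : Set
  Connected = ∀ u v → Star UAdj u v

  record IsNetwork : Set where
    field
      loopless     : Loopless
      acyclic      : Acyclic
      connected    : Connected
      leaves≥2     : 2 ≤ numLeaves
      root-out     : ∀ v → indeg v ≡ 0 → 2 ≤ outdeg v
      sink-leaf    : ∀ v → outdeg v ≡ 0 → indeg v ≡ 1
      no-deg-1-1   : ∀ v → ¬ (indeg v ≡ 1 × outdeg v ≡ 1)

  UCycle : Set
  UCycle = Σ Vtx λ x → Σ (List Vtx) λ ys →
             2 ≤ length ys × Unique (x ∷ ys) × Linked UAdj (x ∷ ys ++ x ∷ [])

  Arboreal : Set
  Arboreal = Connected × ¬ UCycle

  pathVs : Vtx → List Vtx → Vtx → List Vtx
  pathVs u mid v = u ∷ mid ++ v ∷ []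

  -- mid is the list of internal vertices of a directed path from u to v
  -- (with u ≠ v)
  DPath : Vtx → List Vtx → Vtx → Set
  DPath u mid v = Linked Edge (pathVs u mid v) × Unique (pathVs u mid v)

  InternallyDisjoint : Vtx → List Vtx → Vtx → Vtx → List Vtx → Vtx → Set
  InternallyDisjoint u mid v u' mid' v' =
    (∀ x → x ∈ mid → x ∉ pathVs u' mid' v') ×
    (∀ x → x ∈ mid' → x ∉ pathVs u mid v)

  nextIx : ∀ {m} → Fin (suc m) → Fin (suc m)
  nextIx {m} i = suc (toℕ i) mod (suc m)

  -- a (suc m)-alternating cycle v₀,h₀,…,v_m,h_m (vertices pairwise distinct)
  record AltCycle (m : ℕ) : Set where
    field
      v h       : Fin (suc m) → Vtx
      v-inj     : Injective _≡_ _≡_ v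
      h-inj     : Injective _≡_ _≡_ h
      v≢h       : ∀ i j → v i ≢ h j
      hybrid    : ∀ i → Hybrid (h i)
      midL midR : Fin (suc m) → List Vtx
      pathL     : ∀ i → DPath (v i) (midL i) (h i)
      pathR     : ∀ i → DPath (v (nextIx i)) (midR i) (h i)
      distinct  : ∀ i → pathVs (v i) (midL i) (h i) ≢ pathVs (v (nextIx i)) (midR i) (h i)
      disjoint  : ∀ i → InternallyDisjoint (v i) (midL i) (h i) (v (nextIx i)) (midR i) (h i)

  HasAltCycle : Set
  HasAltCycle = Σ ℕ AltCycle

{-# OPTIONS --safe #-}
-- Counting in-degrees gives h̃ + n = (number of arcs) + r, so h̃ = r − 1 says that the connected
-- underlying graph has n − 1 edges, i.e. is a tree; this is seen by a union–find pass over the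
-- arcs, in which every arc either merges two components or closes a cycle.
-- Given an alternating cycle, pick a hybrid h that lies on none of the other paths (one that is
-- maximal for reachability among the hᵢ); removing h from the closed walk formed by the paths
-- leaves a walk between its two in-neighbours avoiding h, i.e. an undirected cycle through h.
-- Conversely, rotate an undirected cycle to start at a vertex with no in-neighbour on it (it
-- exists by acyclicity) and cut it into maximal forward and backward runs: the run tops are
-- hybrids, the run bottoms are the vᵢ of an alternating cycle.
module Submission where

open import Defs
open import Data.Bool using (Bool; true; false; if_then_else_)
import Data.Bool.Properties as Bool
open import Data.Empty using (⊥; ⊥-elim)
open import Data.Unit using (tt)
open import Data.Fin using (Fin; zero; suc; toℕ; fromℕ; inject₁; lower₁)
open import Data.Fin.Induction using (spo-wellFounded)
open import Data.Fin.Properties using (_≟_; any?; suc-injective; toℕ-injective; toℕ-fromℕ; toℕ-fromℕ<; toℕ<n;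
  toℕ-inject₁; toℕ-lower₁; inject₁-lower₁)
open import Data.List using (List; []; _∷_; _++_; length; map; reverse; lookup)
open import Data.List.Properties using (++-assoc; ++-identityʳ; length-++; length-map; reverse-++; ∷-injective; ∷ʳ-injectiveˡ)
open import Data.List.Membership.Propositional using (_∈_; _∉_)
open import Data.List.Membership.Propositional.Properties using (∈-++⁻; ∈-++⁺ˡ; ∈-++⁺ʳ; ∈-map⁺; ∈-map⁻; ∈-∃++)
open import Data.List.Relation.Binary.Disjoint.Propositional using (Disjoint)
open import Data.List.Relation.Unary.Any using (here; there)
import Data.List.Relation.Unary.Any.Properties as Any
open import Data.List.Relation.Unary.All.Properties using (¬Any⇒All¬)
open import Data.List.Relation.Unary.AllPairs using (_∷_)
open import Data.List.Relation.Unary.Linked using (Linked; []; [-]; _∷_)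
import Data.List.Relation.Unary.Linked as Linked
open import Data.List.Relation.Unary.Unique.Propositional using (Unique; [])
import Data.List.Relation.Unary.Unique.Propositional.Properties as Unique
open import Data.List.Relation.Unary.Unique.Propositional.Properties using (Unique[x∷xs]⇒x∉xs)
open import Data.Nat using (ℕ; zero; suc; _+_; _∸_; _≤_; _<_; z≤n; s≤s; s<s⁻¹; _≡ᵇ_; _%_)
open import Data.Nat.DivMod using (_mod_; m%n<n; m<n⇒m%n≡m; [m+n]%n≡m%n; %-distribˡ-+; m%n%n≡m%n; n%n≡0)
open import Data.Nat.Properties using (+-suc; +-assoc; +-comm; +-identityʳ; +-cancelˡ-≡; +-cancelʳ-<; +-mono-<;
  ≤-refl; ≤-trans; ≤-pred; <⇒≤; <-irrefl; <-trans; <-≤-trans; ≮⇒≥; ≤∧≢⇒<; m∸n+n≡m; m≢1+m+n; 1+n≢n; m≤n+m; n<1+n)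
import Data.Nat as ℕ
open import Data.Product using (∃; ∃₂; _×_; _,_; proj₁; proj₂)
open import Data.Sum using (_⊎_; inj₁; inj₂)
import Data.Sum as Sum
open import Function using (_∘_; id; flip)
open import Function.Bundles using (_⇔_; mk⇔; Equivalence)
open import Relation.Binary.Construct.Closure.ReflexiveTransitive using (Star; ε; _◅_; _◅◅_; gmap)
import Relation.Binary.Construct.Closure.ReflexiveTransitive as Star
open import Induction.WellFounded using (WellFounded; Acc; acc)
open import Relation.Binary.Definitions using (DecidableEquality)
open import Relation.Binary.Structures using (IsStrictPartialOrder)
import Relation.Binary.Construct.Flip.EqAndOrd as Flip
import Relation.Binary.Construct.On as On
open import Relation.Binary.PropositionalEquality using (_≡_; _≢_; refl; sym; trans; cong; cong₂; subst;
  isEquivalence; resp₂; module ≡-Reasoning)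
open import Relation.Nullary using (¬_; Dec; yes; no; does)
open import Relation.Nullary.Decidable using (_×-dec_; _⊎-dec_; ¬?; decidable-stable; dec-true; dec-false)

module Lists {A : Set} where

  lastOf : A → List A → A
  lastOf a []       = a
  lastOf a (x ∷ xs) = lastOf x xs

  lastOf-++ : ∀ c ys a zs → lastOf c (ys ++ a ∷ zs) ≡ lastOf a zs
  lastOf-++ c []       a zs = refl
  lastOf-++ c (y ∷ ys) a zs = lastOf-++ y ys a zs

  lastOf-∷ʳ : ∀ a xs t → lastOf a (xs ++ t ∷ []) ≡ t
  lastOf-∷ʳ a xs t = lastOf-++ a xs t []

  lastOf-≡-++ : ∀ c xs ys a zs → c ∷ xs ≡ ys ++ a ∷ zs → lastOf c xs ≡ lastOf a zs
  lastOf-≡-++ c xs []       a zs refl = refl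
  lastOf-≡-++ c xs (y ∷ ys) a zs refl = lastOf-++ c ys a zs

  lastOf-∈ : ∀ a xs → lastOf a xs ∈ a ∷ xs
  lastOf-∈ a []       = here refl
  lastOf-∈ a (x ∷ xs) = there (lastOf-∈ x xs)

  Unique-∷ : ∀ {x : A} {xs} → x ∉ xs → Unique xs → Unique (x ∷ xs)
  Unique-∷ {xs = xs} x∉xs u = ¬Any⇒All¬ xs x∉xs ∷ u

  Unique-tail : ∀ {x : A} {xs} → Unique (x ∷ xs) → Unique xs
  Unique-tail (_ ∷ u) = u

  Unique-++⁻ : ∀ xs {ys : List A} → Unique (xs ++ ys) → Unique xs × Unique ys × Disjoint xs ys
  Unique-++⁻ []       u = [] , u , λ ()
  Unique-++⁻ (x ∷ xs) u with Unique-++⁻ xs (Unique-tail u)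
  ... | uxs , uys , xs#ys = Unique-∷ (Unique[x∷xs]⇒x∉xs u ∘ ∈-++⁺ˡ) uxs , uys , disjoint
    where
    disjoint : Disjoint (x ∷ xs) _
    disjoint (here refl , y∈ys) = Unique[x∷xs]⇒x∉xs u (∈-++⁺ʳ xs y∈ys)
    disjoint (there y∈xs , y∈ys) = xs#ys (y∈xs , y∈ys)

  Unique-++-comm : ∀ xs ys → Unique (xs ++ ys) → Unique (ys ++ xs)
  Unique-++-comm xs ys u with Unique-++⁻ xs u
  ... | uxs , uys , xs#ys = Unique.++⁺ uys uxs (λ (p , q) → xs#ys (q , p))

  ∈-++-comm : ∀ {w : A} xs ys → w ∈ xs ++ ys → w ∈ ys ++ xs
  ∈-++-comm xs ys w∈ with ∈-++⁻ xs w∈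
  ... | inj₁ w∈xs = ∈-++⁺ʳ ys w∈xs
  ... | inj₂ w∈ys = ∈-++⁺ˡ w∈ys

  Unique-reverse : (xs : List A) → Unique xs → Unique (reverse xs)
  Unique-reverse []       u = u
  Unique-reverse (x ∷ xs) u = subst Unique (sym (reverse-++ (x ∷ []) xs))
    (Unique.++⁺ (Unique-reverse xs (Unique-tail u)) (Unique-∷ (λ ()) [])
      λ { (y∈xs , here refl) → Unique[x∷xs]⇒x∉xs u (Any.reverse⁻ y∈xs) })

  Unique-∷ʳ : ∀ {x : A} xs → x ∉ xs → Unique xs → Unique (xs ++ x ∷ [])
  Unique-∷ʳ xs x∉xs u = Unique.++⁺ u (Unique-∷ (λ ()) []) λ { (y∈xs , here refl) → x∉xs y∈xs }

  lastOf-self : ∀ {a : A} xs → a ∉ xs → lastOf a xs ≡ a → xs ≡ []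
  lastOf-self []       _   _ = refl
  lastOf-self (c ∷ xs) a∉ e = ⊥-elim (a∉ (subst (_∈ c ∷ xs) e (lastOf-∈ c xs)))

  ≡reverse⇒[] : ∀ (xs ys : List A) → xs ≡ reverse ys → Disjoint xs ys → xs ≡ [] × ys ≡ []
  ≡reverse⇒[] []       []       _ _    = refl , refl
  ≡reverse⇒[] []       (c ∷ ys) e _    with subst (c ∈_) (sym e) (Any.reverse⁺ {xs = c ∷ ys} (here refl))
  ... | ()
  ≡reverse⇒[] (c ∷ xs) ys       e xs#ys = ⊥-elim (xs#ys (here refl , Any.reverse⁻ (subst (c ∈_) e (here refl))))

  Unique-path : ∀ {v h : A} {xs} → v ∉ xs → v ≢ h → h ∉ xs → Unique xs → Unique (v ∷ xs ++ h ∷ [])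
  Unique-path {v} {h} {xs} v∉ v≢h h∉ u = Unique-∷ v∉xs++h (Unique-∷ʳ xs h∉ u)
    where
    v∉xs++h : v ∉ xs ++ h ∷ []
    v∉xs++h v∈ with ∈-++⁻ xs v∈
    ... | inj₁ v∈xs        = v∉ v∈xs
    ... | inj₂ (here v≡h)  = v≢h v≡h

  module _ {R : A → A → Set} where

    Linked-∷ʳ : ∀ a xs t → Linked R (a ∷ xs) → R (lastOf a xs) t → Linked R (a ∷ xs ++ t ∷ [])
    Linked-∷ʳ a []       t [-]       r = r ∷ [-]
    Linked-∷ʳ a (x ∷ xs) t (r₀ ∷ l) r = r₀ ∷ Linked-∷ʳ x xs t l r

    Linked-last : ∀ a xs t → Linked R (a ∷ xs ++ t ∷ []) → R (lastOf a xs) t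
    Linked-last a []       t (r ∷ _) = r
    Linked-last a (x ∷ xs) t (_ ∷ l) = Linked-last x xs t l

    Linked-init : ∀ a xs t → Linked R (a ∷ xs ++ t ∷ []) → Linked R (a ∷ xs)
    Linked-init a []       t _       = [-]
    Linked-init a (x ∷ xs) t (r ∷ l) = r ∷ Linked-init x xs t l

    Linked-split : ∀ xs {y ys} → Linked R (xs ++ y ∷ ys) → Linked R (xs ++ y ∷ []) × Linked R (y ∷ ys)
    Linked-split []           l       = [-] , l
    Linked-split (x ∷ [])     (r ∷ l) = (r ∷ [-]) , l
    Linked-split (x ∷ x′ ∷ xs) (r ∷ l) with Linked-split (x′ ∷ xs) l
    ... | l₁ , l₂ = (r ∷ l₁) , l₂

    Linked-join : ∀ xs {y ys} → Linked R (xs ++ y ∷ []) → Linked R (y ∷ ys) → Linked R (xs ++ y ∷ ys)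
    Linked-join []            _        l = l
    Linked-join (x ∷ [])      (r ∷ _)  l = r ∷ l
    Linked-join (x ∷ x′ ∷ xs) (r ∷ l₁) l = r ∷ Linked-join (x′ ∷ xs) l₁ l

    Linked-drop : ∀ xs {ys} → Linked R (xs ++ ys) → Linked R ys
    Linked-drop []       l = l
    Linked-drop (x ∷ xs) l = Linked-drop xs (Linked.tail l)

    Linked⇒Star : ∀ a xs → Linked R (a ∷ xs) → Star R a (lastOf a xs)
    Linked⇒Star a []       _       = ε
    Linked⇒Star a (x ∷ xs) (r ∷ l) = r ◅ Linked⇒Star x xs l

    Linked-reverse : ∀ h xs w → Linked (flip R) (h ∷ xs ++ w ∷ []) → Linked R (w ∷ reverse xs ++ h ∷ [])
    Linked-reverse h []       w (r ∷ [-]) = r ∷ [-]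
    Linked-reverse h (c ∷ xs) w (r ∷ l) =
      subst (λ ys → Linked R (w ∷ ys ++ h ∷ [])) (sym (reverse-++ (c ∷ []) xs))
        (Linked-∷ʳ w (reverse xs ++ c ∷ []) h (Linked-reverse c xs w l)
          (subst (λ z → R z h) (sym (lastOf-∷ʳ w (reverse xs) c)) r))

    Linked-pointwise : ∀ {P : A → Set} a xs → Linked R (a ∷ xs) → (∀ w → w ∈ a ∷ xs → P w) →
                       Linked (λ u v → R u v × P u × P v) (a ∷ xs)
    Linked-pointwise a []       _       _ = [-]
    Linked-pointwise a (x ∷ xs) (r ∷ l) p =
      (r , p a (here refl) , p x (there (here refl))) ∷ Linked-pointwise x xs l (λ w → p w ∘ there)

open Lists

sumFin-∸1 : ∀ {k} (f : Fin k → ℕ) → sumFin (λ v → f v ∸ 1) + k ≡ sumFin f + count (λ v → f v ≡ᵇ 0)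
sumFin-∸1 {zero}  f = refl
sumFin-∸1 {suc k} f = step (f zero) (sumFin-∸1 (f ∘ suc))
  where
  open ≡-Reasoning
  s∸ s c : ℕ
  s∸ = sumFin (λ v → f (suc v) ∸ 1)
  s  = sumFin (f ∘ suc)
  c  = count (λ v → f (suc v) ≡ᵇ 0)
  step : ∀ x → s∸ + k ≡ s + c → (x ∸ 1 + s∸) + suc k ≡ (x + s) + ((if x ≡ᵇ 0 then 1 else 0) + c)
  step zero ih = begin
    s∸ + suc k             ≡⟨ +-suc s∸ k ⟩
    suc (s∸ + k)           ≡⟨ cong suc ih ⟩
    suc (s + c)            ≡⟨ +-suc s c ⟨
    s + suc c              ∎
  step (suc a) ih = begin
    (a + s∸) + suc k       ≡⟨ +-suc (a + s∸) k ⟩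
    suc ((a + s∸) + k)     ≡⟨ cong suc (+-assoc a s∸ k) ⟩
    suc (a + (s∸ + k))     ≡⟨ cong (λ z → suc (a + z)) ih ⟩
    suc (a + (s + c))      ≡⟨ cong suc (+-assoc a s c) ⟨
    suc a + s + c          ∎

count-cong : ∀ {k} {f g : Fin k → Bool} → (∀ x → f x ≡ g x) → count f ≡ count g
count-cong {zero}  f≗g = refl
count-cong {suc k} f≗g rewrite f≗g zero = cong (_ +_) (count-cong (f≗g ∘ suc))

count-false : ∀ {k} → count {k} (λ _ → false) ≡ 0
count-false {zero}  = refl
count-false {suc k} = count-false {k}

count-drop : ∀ {k} (f g : Fin k → Bool) p → (∀ x → x ≢ p → f x ≡ g x) →
             f p ≡ true → g p ≡ false → count f ≡ suc (count g)
count-drop {suc k} f g zero f≗g fp gp rewrite fp | gp =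
  cong suc (count-cong (λ x → f≗g (suc x) λ ()))
count-drop {suc k} f g (suc p) f≗g fp gp rewrite f≗g zero (λ ()) =
  trans (cong (_ +_) (count-drop (f ∘ suc) (g ∘ suc) p (λ x x≢p → f≗g (suc x) (x≢p ∘ suc-injective)) fp gp))
        (+-suc _ _)

count-≥1 : ∀ {k} (f : Fin k → Bool) a → f a ≡ true → 1 ≤ count f
count-≥1 f zero    fa rewrite fa = s≤s z≤n
count-≥1 f (suc a) fa with f zero
... | true  = s≤s z≤n
... | false = count-≥1 (f ∘ suc) a fa

count-≥2 : ∀ {k} (f : Fin k → Bool) a b → a ≢ b → f a ≡ true → f b ≡ true → 2 ≤ count f
count-≥2 {k} f a b a≢b fa fb =
  subst (2 ≤_) (sym (count-drop f g a f≗g fa ga))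
    (s≤s (count-≥1 g b (trans (sym (f≗g b (a≢b ∘ sym))) fb)))
  where
  g : Fin k → Bool
  g x = if does (x ≟ a) then false else f x
  f≗g : ∀ x → x ≢ a → f x ≡ g x
  f≗g x x≢a rewrite dec-false (x ≟ a) x≢a = refl
  ga : g a ≡ false
  ga rewrite dec-true (a ≟ a) refl = refl

count-≟-refl : ∀ {k} → count {k} (λ x → does (x ≟ x)) ≡ k
count-≟-refl {zero}  = refl
count-≟-refl {suc k} rewrite dec-true (zero {k} ≟ zero) refl =
  cong suc (trans (count-cong {k} λ x → trans (dec-true (suc x ≟ suc x) refl) (sym (dec-true (x ≟ x) refl)))
                  count-≟-refl)

count-≟ : ∀ {k} (c : Fin k) → count (λ x → does (c ≟ x)) ≡ 1
count-≟ {k} c =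
  trans (count-drop _ (λ _ → false) c (λ x x≢c → dec-false (c ≟ x) (x≢c ∘ sym)) (dec-true (c ≟ c) refl) refl)
        (cong suc (count-false {k}))

count-≥1⇒Fin : ∀ {k} (f : Fin k → Bool) → 1 ≤ count f → Fin k
count-≥1⇒Fin {zero}  f ()
count-≥1⇒Fin {suc k} f _ = zero

sumFin-cong : ∀ {k} {f g : Fin k → ℕ} → (∀ x → f x ≡ g x) → sumFin f ≡ sumFin g
sumFin-cong {zero}  f≗g = refl
sumFin-cong {suc k} f≗g = cong₂ _+_ (f≗g zero) (sumFin-cong (f≗g ∘ suc))

finsWhere : ∀ {k} → (Fin k → Bool) → List (Fin k)
finsWhere {zero}  f = []
finsWhere {suc k} f = if f zero then zero ∷ rest else rest
  where
  rest : List (Fin (suc k))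
  rest = map suc (finsWhere (f ∘ suc))

length-finsWhere : ∀ {k} (f : Fin k → Bool) → length (finsWhere f) ≡ count f
length-finsWhere {zero}  f = refl
length-finsWhere {suc k} f with f zero
... | true  = cong suc (trans (length-map suc (finsWhere (f ∘ suc))) (length-finsWhere (f ∘ suc)))
... | false = trans (length-map suc (finsWhere (f ∘ suc))) (length-finsWhere (f ∘ suc))

∈-finsWhere⁺ : ∀ {k} (f : Fin k → Bool) {x} → f x ≡ true → x ∈ finsWhere f
∈-finsWhere⁺ {suc k} f {zero}  fx rewrite fx = here refl
∈-finsWhere⁺ {suc k} f {suc x} fx with f zero
... | true  = there (∈-map⁺ suc (∈-finsWhere⁺ (f ∘ suc) fx))
... | false = ∈-map⁺ suc (∈-finsWhere⁺ (f ∘ suc) fx)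

∈-finsWhere⁻ : ∀ {k} (f : Fin k → Bool) {x} → x ∈ finsWhere f → f x ≡ true
∈-finsWhere⁻ {suc k} f x∈ with f zero in f0
∈-finsWhere⁻ {suc k} f (here refl) | true = f0
∈-finsWhere⁻ {suc k} f (there x∈)  | true with ∈-map⁻ suc x∈
... | _ , y∈ , refl = ∈-finsWhere⁻ (f ∘ suc) y∈
∈-finsWhere⁻ {suc k} f x∈          | false with ∈-map⁻ suc x∈
... | _ , y∈ , refl = ∈-finsWhere⁻ (f ∘ suc) y∈

finsWhere-Unique : ∀ {k} (f : Fin k → Bool) → Unique (finsWhere f)
finsWhere-Unique {zero}  f = []
finsWhere-Unique {suc k} f with f zero
... | true  = Unique-∷ zero∉ (Unique.map⁺ suc-injective (finsWhere-Unique (f ∘ suc)))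
  where
  zero∉ : zero ∉ map suc (finsWhere (f ∘ suc))
  zero∉ z∈ with ∈-map⁻ suc z∈
  ... | _ , _ , ()
... | false = Unique.map⁺ suc-injective (finsWhere-Unique (f ∘ suc))

concatFin : ∀ {k} {B : Set} → (Fin k → List B) → List B
concatFin {zero}  g = []
concatFin {suc k} g = g zero ++ concatFin (g ∘ suc)

length-concatFin : ∀ {k} {B : Set} (g : Fin k → List B) → length (concatFin g) ≡ sumFin (length ∘ g)
length-concatFin {zero}  g = refl
length-concatFin {suc k} g = trans (length-++ (g zero)) (cong (length (g zero) +_) (length-concatFin (g ∘ suc)))

∈-concatFin⁺ : ∀ {k} {B : Set} (g : Fin k → List B) i {b} → b ∈ g i → b ∈ concatFin g
∈-concatFin⁺ {suc k} g zero    b∈ = ∈-++⁺ˡ b∈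
∈-concatFin⁺ {suc k} g (suc i) b∈ = ∈-++⁺ʳ (g zero) (∈-concatFin⁺ (g ∘ suc) i b∈)

∈-concatFin⁻ : ∀ {k} {B : Set} (g : Fin k → List B) {b} → b ∈ concatFin g → ∃ λ i → b ∈ g i
∈-concatFin⁻ {suc k} g b∈ with ∈-++⁻ (g zero) b∈
... | inj₁ b∈₀ = zero , b∈₀
... | inj₂ b∈ᵣ with ∈-concatFin⁻ (g ∘ suc) b∈ᵣ
... | i , b∈ᵢ = suc i , b∈ᵢ

concatFin-Unique : ∀ {k} {B : Set} (g : Fin k → List B) → (∀ i → Unique (g i)) →
                   (∀ {b} i j → b ∈ g i → b ∈ g j → i ≡ j) → Unique (concatFin g)
concatFin-Unique {zero}  g u d = []
concatFin-Unique {suc k} g u d =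
  Unique.++⁺ (u zero) (concatFin-Unique (g ∘ suc) (u ∘ suc) (λ i j p q → suc-injective (d (suc i) (suc j) p q)))
    λ (b∈₀ , b∈ᵣ) → zero≢suc (∈-concatFin⁻ (g ∘ suc) b∈ᵣ) b∈₀
  where
  zero≢suc : ∀ {b} → (∃ λ i → b ∈ g (suc i)) → b ∉ g zero
  zero≢suc (i , b∈ᵢ) b∈₀ with d zero (suc i) b∈₀ b∈ᵢ
  ... | ()

module Walks {A : Set} where

  SameEdge : A → A → A → A → Set
  SameEdge a b u v = (u ≡ a × v ≡ b) ⊎ (u ≡ b × v ≡ a)

  Star-∪-edge : ∀ {R : A → A → Set} {a b x y} → Star (λ u v → R u v ⊎ SameEdge a b u v) x y →
                Star R x y ⊎ (Star R x a × Star R b y) ⊎ (Star R x b × Star R a y) ⊎ Star R a b ⊎ Star R b a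
  Star-∪-edge ε = inj₁ ε
  Star-∪-edge (inj₁ r ◅ s) with Star-∪-edge s
  ... | inj₁ s′                         = inj₁ (r ◅ s′)
  ... | inj₂ (inj₁ (s₁ , s₂))           = inj₂ (inj₁ (r ◅ s₁ , s₂))
  ... | inj₂ (inj₂ (inj₁ (s₁ , s₂)))    = inj₂ (inj₂ (inj₁ (r ◅ s₁ , s₂)))
  ... | inj₂ (inj₂ (inj₂ t))            = inj₂ (inj₂ (inj₂ t))
  Star-∪-edge (inj₂ (inj₁ (refl , refl)) ◅ s) with Star-∪-edge s
  ... | inj₁ s′                         = inj₂ (inj₁ (ε , s′))
  ... | inj₂ (inj₁ (s₁ , _))            = inj₂ (inj₂ (inj₂ (inj₂ s₁)))
  ... | inj₂ (inj₂ (inj₁ (_ , s₂)))     = inj₁ s₂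
  ... | inj₂ (inj₂ (inj₂ t))            = inj₂ (inj₂ (inj₂ t))
  Star-∪-edge (inj₂ (inj₂ (refl , refl)) ◅ s) with Star-∪-edge s
  ... | inj₁ s′                         = inj₂ (inj₂ (inj₁ (ε , s′)))
  ... | inj₂ (inj₁ (_ , s₂))            = inj₁ s₂
  ... | inj₂ (inj₂ (inj₁ (s₁ , _)))     = inj₂ (inj₂ (inj₂ (inj₁ s₁)))
  ... | inj₂ (inj₂ (inj₂ t))            = inj₂ (inj₂ (inj₂ t))

  module _ (_≟ᴬ_ : DecidableEquality A) {R : A → A → Set} where
    open import Data.List.Membership.DecPropositional _≟ᴬ_ using (_∈?_)

    Star⇒path : ∀ {a b} → Star R a b → ∃ λ xs → Linked R (a ∷ xs) × Unique (a ∷ xs) × lastOf a xs ≡ b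
    Star⇒path ε = [] , [-] , Unique-∷ (λ ()) [] , refl
    Star⇒path {a} (_◅_ {j = c} r s) with Star⇒path s
    ... | xs , l , u , e with a ∈? (c ∷ xs)
    ...   | no a∉ = c ∷ xs , r ∷ l , Unique-∷ a∉ u , e
    ...   | yes a∈ with ∈-∃++ a∈
    ...     | ys , zs , eq =
      zs , Linked-drop ys (subst (Linked R) eq l) , proj₁ (proj₂ (Unique-++⁻ ys (subst Unique eq u))) ,
      trans (sym (lastOf-≡-++ c xs ys a zs eq)) e

open Walks

module UnionFind {k : ℕ} where

  Pair : Set
  Pair = Fin k × Fin k

  Joins : List Pair → Fin k → Fin k → Set
  Joins ps u v = (u , v) ∈ ps ⊎ (v , u) ∈ ps

  Joins-sym : ∀ {ps u v} → Joins ps u v → Joins ps v u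
  Joins-sym (inj₁ m) = inj₂ m
  Joins-sym (inj₂ m) = inj₁ m

  Joins-∷ : ∀ {p ps u v} → Joins ps u v → Joins (p ∷ ps) u v
  Joins-∷ (inj₁ m) = inj₁ (there m)
  Joins-∷ (inj₂ m) = inj₂ (there m)

  Star-Joins-∷ : ∀ {p ps x y} → Star (Joins ps) x y → Star (Joins (p ∷ ps)) x y
  Star-Joins-∷ = gmap id Joins-∷

  relabel : (Fin k → Fin k) → Fin k → Fin k → Fin k → Fin k
  relabel L a b x with L x ≟ L b
  ... | yes _ = L a
  ... | no  _ = L x

  relabel-yes : ∀ L a b {x} → L x ≡ L b → relabel L a b x ≡ L a
  relabel-yes L a b {x} e with L x ≟ L b
  ... | yes _ = refl
  ... | no ne = ⊥-elim (ne e)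

  relabel-no : ∀ L a b {x} → L x ≢ L b → relabel L a b x ≡ L x
  relabel-no L a b {x} ne with L x ≟ L b
  ... | yes e = ⊥-elim (ne e)
  ... | no  _ = refl

  relabel-cong : ∀ L a b {x y} → L x ≡ L y → relabel L a b x ≡ relabel L a b y
  relabel-cong L a b {x} {y} e with L x ≟ L b | L y ≟ L b
  ... | yes _  | yes _  = refl
  ... | yes ex | no ny  = ⊥-elim (ny (trans (sym e) ex))
  ... | no nx  | yes ey = ⊥-elim (nx (trans e ey))
  ... | no _   | no _   = e

  -- Union–find, adding the pairs of ps from the last to the first: label ps sends every vertex to a
  -- representative of its component in the graph with edge set ps, and redundant ps counts the
  -- pairs whose endpoints were already connected when they were added.
  label : List Pair → Fin k → Fin k
  label [] = id
  label ((a , b) ∷ ps) with label ps a ≟ label ps b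
  ... | yes _ = label ps
  ... | no  _ = relabel (label ps) a b

  redundant : List Pair → ℕ
  redundant [] = 0
  redundant ((a , b) ∷ ps) with label ps a ≟ label ps b
  ... | yes _ = suc (redundant ps)
  ... | no  _ = redundant ps

  classes : (Fin k → Fin k) → ℕ
  classes L = count (λ x → does (L x ≟ x))

  label-idem : ∀ ps x → label ps (label ps x) ≡ label ps x
  label-idem [] x = refl
  label-idem ((a , b) ∷ ps) x with label ps a ≟ label ps b
  ... | yes _ = label-idem ps x
  ... | no ne with label ps x ≟ label ps b
  ...   | yes _  = trans (relabel-no (label ps) a b (ne ∘ trans (sym (label-idem ps a)))) (label-idem ps a)
  ...   | no nx = trans (relabel-no (label ps) a b (nx ∘ trans (sym (label-idem ps x)))) (label-idem ps x)

  label≡⇒Star : ∀ ps x y → label ps x ≡ label ps y → Star (Joins ps) x y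
  label≡⇒Star [] x y refl = ε
  label≡⇒Star ((a , b) ∷ ps) x y e with label ps a ≟ label ps b
  ... | yes _ = Star-Joins-∷ (label≡⇒Star ps x y e)
  ... | no _ with label ps x ≟ label ps b | label ps y ≟ label ps b
  ...   | yes ex | yes ey = Star-Joins-∷ (label≡⇒Star ps x y (trans ex (sym ey)))
  ...   | yes ex | no _   =
    Star-Joins-∷ (label≡⇒Star ps x b ex) ◅◅ inj₂ (here refl) ◅ Star-Joins-∷ (label≡⇒Star ps a y e)
  ...   | no _   | yes ey =
    Star-Joins-∷ (label≡⇒Star ps x a e) ◅◅ inj₁ (here refl) ◅ Star-Joins-∷ (label≡⇒Star ps b y (sym ey))
  ...   | no _   | no _   = Star-Joins-∷ (label≡⇒Star ps x y e)

  Joins⇒label≡ : ∀ ps {x y} → Joins ps x y → label ps x ≡ label ps y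
  Joins⇒label≡ [] (inj₁ ())
  Joins⇒label≡ [] (inj₂ ())
  Joins⇒label≡ ((a , b) ∷ ps) j with label ps a ≟ label ps b
  Joins⇒label≡ ((a , b) ∷ ps) (inj₁ (here refl)) | yes e = e
  Joins⇒label≡ ((a , b) ∷ ps) (inj₂ (here refl)) | yes e = sym e
  Joins⇒label≡ ((a , b) ∷ ps) (inj₁ (there m))   | yes _ = Joins⇒label≡ ps (inj₁ m)
  Joins⇒label≡ ((a , b) ∷ ps) (inj₂ (there m))   | yes _ = Joins⇒label≡ ps (inj₂ m)
  Joins⇒label≡ ((a , b) ∷ ps) (inj₁ (here refl)) | no ne =
    trans (relabel-no (label ps) a b ne) (sym (relabel-yes (label ps) a b refl))
  Joins⇒label≡ ((a , b) ∷ ps) (inj₂ (here refl)) | no ne =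
    trans (relabel-yes (label ps) a b refl) (sym (relabel-no (label ps) a b ne))
  Joins⇒label≡ ((a , b) ∷ ps) (inj₁ (there m))   | no _ =
    relabel-cong (label ps) a b (Joins⇒label≡ ps (inj₁ m))
  Joins⇒label≡ ((a , b) ∷ ps) (inj₂ (there m))   | no _ =
    relabel-cong (label ps) a b (Joins⇒label≡ ps (inj₂ m))

  Star⇒label≡ : ∀ ps {R : Fin k → Fin k → Set} → (∀ {u v} → R u v → Joins ps u v) →
                ∀ {x y} → Star R x y → label ps x ≡ label ps y
  Star⇒label≡ ps R⇒J ε       = refl
  Star⇒label≡ ps R⇒J (r ◅ s) = trans (Joins⇒label≡ ps (R⇒J r)) (Star⇒label≡ ps R⇒J s)

  classes-relabel : ∀ ps a b → label ps a ≢ label ps b →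
                    classes (label ps) ≡ suc (classes (relabel (label ps) a b))
  classes-relabel ps a b ne = count-drop _ _ (L b) agree (dec-true (L (L b) ≟ L b) (label-idem ps b)) dropped
    where
    L : Fin k → Fin k
    L = label ps
    dropped : does (relabel L a b (L b) ≟ L b) ≡ false
    dropped rewrite relabel-yes L a b (label-idem ps b) = dec-false (L a ≟ L b) ne
    agree : ∀ x → x ≢ L b → does (L x ≟ x) ≡ does (relabel L a b x ≟ x)
    agree x x≢Lb with L x ≟ L b
    ... | yes ex = trans (dec-false (L x ≟ x) λ e → x≢Lb (trans (sym e) ex))
                         (sym (dec-false (L a ≟ x) λ e → ne (trans (sym (label-idem ps a)) (trans (cong L e) ex))))
    ... | no  _  = refl

  classes+length : ∀ ps → classes (label ps) + length ps ≡ k + redundant ps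
  classes+length [] = trans (+-identityʳ _) (trans count-≟-refl (sym (+-identityʳ k)))
  classes+length ((a , b) ∷ ps) with label ps a ≟ label ps b | classes+length ps
  ... | yes _  | ih = trans (+-suc _ _) (trans (cong suc ih) (sym (+-suc k _)))
  ... | no  ne | ih = trans (+-suc _ _) (trans (cong (_+ length ps) (sym (classes-relabel ps a b ne))) ih)

  JoinsExcept : List Pair → Fin k → Fin k → Fin k → Fin k → Set
  JoinsExcept ps p q u v = Joins ps u v × ¬ SameEdge p q u v

  cycle⇒redundant : ∀ ps {p q} → Joins ps p q → Star (JoinsExcept ps p q) p q → redundant ps ≢ 0
  cycle⇒redundant [] (inj₁ ()) _
  cycle⇒redundant [] (inj₂ ()) _
  cycle⇒redundant ((a , b) ∷ ps) {p} {q} j s with label ps a ≟ label ps b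
  ... | yes _ = λ ()
  ... | no ne = go j
    where
    split : ∀ {u v} → JoinsExcept ((a , b) ∷ ps) p q u v → JoinsExcept ps p q u v ⊎ SameEdge a b u v
    split (inj₁ (here refl) , _)  = inj₂ (inj₁ (refl , refl))
    split (inj₂ (here refl) , _)  = inj₂ (inj₂ (refl , refl))
    split (inj₁ (there m) , ¬pq) = inj₁ (inj₁ m , ¬pq)
    split (inj₂ (there m) , ¬pq) = inj₁ (inj₂ m , ¬pq)
    label≡ : ∀ {x y} → Star (JoinsExcept ps p q) x y → label ps x ≡ label ps y
    label≡ = Star⇒label≡ ps proj₁
    via-rest : Joins ps p q → redundant ps ≢ 0
    via-rest jpq with Star-∪-edge (gmap id split s)
    ... | inj₁ s′ = cycle⇒redundant ps jpq s′
    ... | inj₂ (inj₁ (s₁ , s₂)) =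
      λ _ → ne (trans (sym (label≡ s₁)) (trans (Joins⇒label≡ ps jpq) (sym (label≡ s₂))))
    ... | inj₂ (inj₂ (inj₁ (s₁ , s₂))) =
      λ _ → ne (trans (label≡ s₂) (trans (sym (Joins⇒label≡ ps jpq)) (label≡ s₁)))
    ... | inj₂ (inj₂ (inj₂ (inj₁ t))) = λ _ → ne (label≡ t)
    ... | inj₂ (inj₂ (inj₂ (inj₂ t))) = λ _ → ne (sym (label≡ t))
    avoiding-ab : ∀ {u v} → JoinsExcept ((a , b) ∷ ps) p q u v → SameEdge p q a b → Joins ps u v
    avoiding-ab r pq≡ab with split r
    ... | inj₁ r′ = proj₁ r′
    ... | inj₂ (inj₁ (refl , refl)) = ⊥-elim (proj₂ r pq≡ab)
    ... | inj₂ (inj₂ (refl , refl)) = ⊥-elim (proj₂ r (swap pq≡ab))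
      where
      swap : ∀ {x y} → SameEdge p q x y → SameEdge p q y x
      swap (inj₁ (e₁ , e₂)) = inj₂ (e₂ , e₁)
      swap (inj₂ (e₁ , e₂)) = inj₁ (e₂ , e₁)
    go : Joins ((a , b) ∷ ps) p q → redundant ps ≢ 0
    go (inj₁ (here refl)) _ = ne (Star⇒label≡ ps (λ r → avoiding-ab r (inj₁ (refl , refl))) s)
    go (inj₂ (here refl)) _ = ne (sym (Star⇒label≡ ps (λ r → avoiding-ab r (inj₂ (refl , refl))) s))
    go (inj₁ (there m)) = via-rest (inj₁ m)
    go (inj₂ (there m)) = via-rest (inj₂ m)

  redundant⇒split : ∀ ps → redundant ps ≢ 0 →
                    ∃₂ λ pre rest → ∃₂ λ a b → ps ≡ pre ++ (a , b) ∷ rest × label rest a ≡ label rest b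
  redundant⇒split [] r≢0 = ⊥-elim (r≢0 refl)
  redundant⇒split ((a , b) ∷ ps) r≢0 with label ps a ≟ label ps b
  ... | yes e = [] , ps , a , b , refl , e
  ... | no _ with redundant⇒split ps r≢0
  ...   | pre , rest , a′ , b′ , refl , e = (a , b) ∷ pre , rest , a′ , b′ , refl , e

+1-exchange : ∀ {x m y r} → x + m ≡ y + r → (x + 1 ≡ r ⇔ y + 1 ≡ m)
+1-exchange {x} {m} {y} {r} e = mk⇔
  (λ x+1≡r → +-cancelˡ-≡ x (y + 1) m (trans (swap x y) (trans (cong (y +_) x+1≡r) (sym e))))
  (λ y+1≡m → +-cancelˡ-≡ y (x + 1) r (trans (swap y x) (trans (cong (x +_) y+1≡m) e)))
  where
  swap : ∀ a b → a + (b + 1) ≡ b + (a + 1)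
  swap a b = trans (sym (+-assoc a b 1)) (trans (cong (_+ 1) (+-comm a b)) (+-assoc b a 1))

-- The cyclic successor; nextIx G unfolds to it, so the lemmas below apply to alternating cycles.
next : ∀ {m} → Fin (suc m) → Fin (suc m)
next {m} i = suc (toℕ i) mod suc m

wrap : ∀ m → ℕ → Fin (suc m)
wrap m k = k mod suc m

toℕ-wrap : ∀ m k → toℕ (wrap m k) ≡ k % suc m
toℕ-wrap m k = toℕ-fromℕ< (m%n<n k (suc m))

next-wrap : ∀ m k → next (wrap m k) ≡ wrap m (suc k)
next-wrap m k = toℕ-injective (begin
  toℕ (next (wrap m k))            ≡⟨ toℕ-wrap m (suc (toℕ (wrap m k))) ⟩
  suc (toℕ (wrap m k)) % M         ≡⟨ cong (λ z → suc z % M) (toℕ-wrap m k) ⟩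
  (1 + k % M) % M                   ≡⟨ %-distribˡ-+ 1 (k % M) M ⟩
  (1 % M + k % M % M) % M           ≡⟨ cong (λ z → (1 % M + z) % M) (m%n%n≡m%n k M) ⟩
  (1 % M + k % M) % M               ≡⟨ %-distribˡ-+ 1 k M ⟨
  suc k % M                         ≡⟨ toℕ-wrap m (suc k) ⟨
  toℕ (wrap m (suc k))             ∎)
  where
  open ≡-Reasoning
  M : ℕ
  M = suc m

wrap-round : ∀ m (i : Fin (suc m)) → wrap m (suc (toℕ i) + m) ≡ i
wrap-round m i = toℕ-injective (begin
  toℕ (wrap m (suc (toℕ i) + m))   ≡⟨ toℕ-wrap m (suc (toℕ i) + m) ⟩
  (suc (toℕ i) + m) % suc m          ≡⟨ cong (_% suc m) (+-suc (toℕ i) m) ⟨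
  (toℕ i + suc m) % suc m            ≡⟨ [m+n]%n≡m%n (toℕ i) (suc m) ⟩
  toℕ i % suc m                      ≡⟨ m<n⇒m%n≡m (toℕ<n i) ⟩
  toℕ i                              ∎)
  where open ≡-Reasoning

%-shift-≢ : ∀ {a t M} .{{_ : ℕ.NonZero M}} → a < M → suc t < M → (a + suc t) % M ≢ a
%-shift-≢ {a} {t} {M} a<M 1+t<M e with (a + suc t) ℕ.<? M
... | yes lt = m≢1+m+n a (sym (trans (sym (+-suc a t)) (trans (sym (m<n⇒m%n≡m lt)) e)))
... | no ¬lt = <-irrefl 1+t≡M 1+t<M
  where
  d : ℕ
  d = (a + suc t) ∸ M
  d+M≡ : d + M ≡ a + suc t
  d+M≡ = m∸n+n≡m (≮⇒≥ ¬lt)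
  d<M : d < M
  d<M = +-cancelʳ-< M d M (subst (_< M + M) (sym d+M≡) (+-mono-< a<M 1+t<M))
  d≡a : d ≡ a
  d≡a = trans (sym (m<n⇒m%n≡m d<M)) (trans (sym ([m+n]%n≡m%n d M)) (trans (cong (_% M) d+M≡) e))
  1+t≡M : suc t ≡ M
  1+t≡M = sym (+-cancelˡ-≡ a M (suc t) (trans (cong (_+ M) (sym d≡a)) d+M≡))

wrap-skips : ∀ m (i : Fin (suc m)) t → t < m → wrap m (suc (toℕ i) + t) ≢ i
wrap-skips m i t t<m e = %-shift-≢ (toℕ<n i) (s≤s t<m)
  (trans (cong (_% suc m) (+-suc (toℕ i) t)) (trans (sym (toℕ-wrap m (suc (toℕ i) + t))) (cong toℕ e)))

Star-around : ∀ {A : Set} {T : A → A → Set} {m} (f : Fin (suc m) → A) (i : Fin (suc m)) →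
              (∀ j → j ≢ i → Star T (f j) (f (next j))) → Star T (f (next i)) (f i)
Star-around {A} {T} {m} f i step = subst (Star T (f (next i))) (cong f (wrap-round m i)) (walk m ≤-refl)
  where
  g : ℕ → A
  g k = f (wrap m k)
  a : ℕ
  a = toℕ i
  walk : ∀ t → t ≤ m → Star T (g (suc a)) (g (suc a + t))
  walk zero    _   = subst (λ z → Star T (g (suc a)) (g z)) (sym (+-identityʳ (suc a))) ε
  walk (suc t) t<m = subst (λ z → Star T (g (suc a)) (g z)) (sym (+-suc (suc a) t))
    (walk t (<⇒≤ t<m) ◅◅ subst (λ z → Star T (g (suc a + t)) (f z)) (next-wrap m (suc a + t))
                                (step (wrap m (suc a + t)) (wrap-skips m i t t<m)))

next-view : ∀ m (i : Fin (suc m)) →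
            (i ≡ fromℕ m × next i ≡ zero) ⊎ ∃ λ j → i ≡ inject₁ j × next i ≡ suc j
next-view m i with toℕ i ℕ.≟ m
... | yes e = inj₁ (toℕ-injective (trans e (sym (toℕ-fromℕ m))) ,
                    toℕ-injective (trans (toℕ-wrap m (suc (toℕ i)))
                                         (trans (cong (λ z → suc z % suc m) e) (n%n≡0 (suc m)))))
... | no ne = inj₂ (lower₁ i (ne ∘ sym) , sym (inject₁-lower₁ i (ne ∘ sym)) ,
                    toℕ-injective (trans (toℕ-wrap m (suc (toℕ i)))
                      (trans (m<n⇒m%n≡m (s≤s (≤∧≢⇒< (≤-pred (toℕ<n i)) ne)))
                             (cong suc (sym (toℕ-lower₁ i (ne ∘ sym)))))))

next-≢ : ∀ m (i : Fin (suc (suc m))) → next i ≢ i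
next-≢ m i e with next-view (suc m) i
... | inj₁ (refl , e₂) with trans (sym e₂) e
...   | ()
next-≢ m i e | inj₂ (j , refl , e₂) = 1+n≢n (trans (cong toℕ (trans (sym e₂) e)) (toℕ-inject₁ j))

module Skeleton (G : Digraph) where

  V : Set
  V = Vtx G

  UAdj-sym : ∀ {u v} → UAdj G u v → UAdj G v u
  UAdj-sym (inj₁ e) = inj₂ e
  UAdj-sym (inj₂ e) = inj₁ e

  arcs : ℕ
  arcs = sumFin (indeg G)

  h̃+n≡arcs+r : h̃ G + n G ≡ arcs + r G
  h̃+n≡arcs+r = sumFin-∸1 (indeg G)

  h̃+1≡r⇔arcs+1≡n : (h̃ G + 1 ≡ r G) ⇔ (arcs + 1 ≡ n G)
  h̃+1≡r⇔arcs+1≡n = +1-exchange h̃+n≡arcs+r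

  arcsInto : V → List (V × V)
  arcsInto v = map (_, v) (finsWhere (λ u → adj G u v))

  arcList : List (V × V)
  arcList = concatFin arcsInto

  length-arcList : length arcList ≡ arcs
  length-arcList = trans (length-concatFin arcsInto)
    (sumFin-cong λ v → trans (length-map (_, v) (finsWhere (λ u → adj G u v))) (length-finsWhere (λ u → adj G u v)))

  ∈-arcList⁺ : ∀ {u v} → Edge G u v → (u , v) ∈ arcList
  ∈-arcList⁺ {u} {v} e = ∈-concatFin⁺ arcsInto v (∈-map⁺ (_, v) (∈-finsWhere⁺ (λ u → adj G u v) e))

  ∈-arcList⁻ : ∀ {u v} → (u , v) ∈ arcList → Edge G u v
  ∈-arcList⁻ uv∈ with ∈-concatFin⁻ arcsInto uv∈
  ... | w , uw∈ with ∈-map⁻ (_, w) uw∈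
  ... | u′ , u′∈ , refl = ∈-finsWhere⁻ (λ u → adj G u w) u′∈

  arcList-Unique : Unique arcList
  arcList-Unique =
    concatFin-Unique arcsInto (λ v → Unique.map⁺ ,-injectiveˡ (finsWhere-Unique (λ u → adj G u v))) same-head
    where
    ,-injectiveˡ : ∀ {v} {x y : V} → (x , v) ≡ (y , v) → x ≡ y
    ,-injectiveˡ refl = refl
    same-head : ∀ {p} i j → p ∈ arcsInto i → p ∈ arcsInto j → i ≡ j
    same-head i j p∈ᵢ p∈ⱼ with ∈-map⁻ _ p∈ᵢ | ∈-map⁻ _ p∈ⱼ
    ... | _ , _ , refl | _ , _ , refl = refl

  Avoid : V → V → V → Set
  Avoid z u v = UAdj G u v × u ≢ z × v ≢ z

  Avoid-sym : ∀ {z u v} → Avoid z u v → Avoid z v u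
  Avoid-sym (uv , u≢z , v≢z) = UAdj-sym uv , v≢z , u≢z

  Linked-Avoid-∉ : ∀ {z} a c xs → Linked (Avoid z) (a ∷ c ∷ xs) → z ∉ a ∷ c ∷ xs
  Linked-Avoid-∉ a c xs       ((_ , a≢z , _) ∷ _) (here refl)         = a≢z refl
  Linked-Avoid-∉ a c []       ((_ , _ , c≢z) ∷ _) (there (here refl)) = c≢z refl
  Linked-Avoid-∉ a c (d ∷ xs) (_ ∷ l)             (there z∈)          = Linked-Avoid-∉ c d xs l z∈

  Star-Avoid-target : ∀ {z x y} → Star (Avoid z) x y → x ≡ y ⊎ y ≢ z
  Star-Avoid-target ε = inj₁ refl
  Star-Avoid-target ((_ , _ , j≢z) ◅ s) with Star-Avoid-target s
  ... | inj₁ refl = inj₂ j≢z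
  ... | inj₂ y≢z  = inj₂ y≢z

  -- An undirected cycle through hub, given by a walk (not necessarily simple) that closes it.
  record WalkCycle : Set where
    constructor walkCycle
    field
      hub a b : V
      hub-a   : UAdj G hub a
      hub-b   : UAdj G hub b
      a≢b     : a ≢ b
      walk    : Star (Avoid hub) a b

  UCycle⇒WalkCycle : UCycle G → WalkCycle
  UCycle⇒WalkCycle (x , []           , () , _)
  UCycle⇒WalkCycle (x , y ∷ []       , s≤s () , _)
  UCycle⇒WalkCycle (x , y ∷ c ∷ ys , _ , u , xy ∷ l) =
    walkCycle x y b xy (UAdj-sym (Linked-last y (c ∷ ys) x l)) y≢b
      (Linked⇒Star y (c ∷ ys) (Linked-pointwise y (c ∷ ys) (Linked-init y (c ∷ ys) x l) ≢x))
    where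
    b : V
    b = lastOf y (c ∷ ys)
    y≢b : y ≢ b
    y≢b e = Unique[x∷xs]⇒x∉xs (Unique-tail u) (subst (_∈ c ∷ ys) (sym e) (lastOf-∈ c ys))
    ≢x : ∀ w → w ∈ y ∷ c ∷ ys → w ≢ x
    ≢x w w∈ refl = Unique[x∷xs]⇒x∉xs u w∈

  WalkCycle⇒UCycle : WalkCycle → UCycle G
  WalkCycle⇒UCycle (walkCycle z a b za zb a≢b s) with Star⇒path _≟_ s
  ... | []     , _ , _ , a≡b = ⊥-elim (a≢b a≡b)
  ... | c ∷ xs , l , u , e   =
    z , a ∷ c ∷ xs , s≤s (s≤s z≤n) , Unique-∷ (Linked-Avoid-∉ a c xs l) u ,
    za ∷ Linked-∷ʳ a (c ∷ xs) z (Linked.map proj₁ l) (subst (λ w → UAdj G w z) (sym e) (UAdj-sym zb))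

  open UnionFind {n G}

  UAdj⇒Joins : ∀ {u v} → UAdj G u v → Joins arcList u v
  UAdj⇒Joins (inj₁ e) = inj₁ (∈-arcList⁺ e)
  UAdj⇒Joins (inj₂ e) = inj₂ (∈-arcList⁺ e)

  WalkCycle⇒redundant : WalkCycle → redundant arcList ≢ 0
  WalkCycle⇒redundant (walkCycle z a b za zb a≢b s) =
    cycle⇒redundant arcList (UAdj⇒Joins za) (Star.reverse except-sym (gmap id except s ◅◅ closing ◅ ε))
    where
    except : ∀ {u v} → Avoid z u v → JoinsExcept arcList z a u v
    except (uv , u≢z , v≢z) =
      UAdj⇒Joins uv , λ { (inj₁ (u≡z , _)) → u≢z u≡z ; (inj₂ (_ , v≡z)) → v≢z v≡z }
    closing : JoinsExcept arcList z a b z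
    closing =
      UAdj⇒Joins (UAdj-sym zb) , λ { (inj₁ (b≡z , _)) → b≢z b≡z ; (inj₂ (b≡a , _)) → a≢b (sym b≡a) }
      where
      b≢z : b ≢ z
      b≢z with Star-Avoid-target s
      ... | inj₁ a≡b = ⊥-elim (a≢b a≡b)
      ... | inj₂ b≢z = b≢z
    except-sym : ∀ {u v} → JoinsExcept arcList z a u v → JoinsExcept arcList z a v u
    except-sym (j , ¬e) =
      Joins-sym j , λ { (inj₁ (e₁ , e₂)) → ¬e (inj₂ (e₂ , e₁)) ; (inj₂ (e₁ , e₂)) → ¬e (inj₁ (e₂ , e₁)) }

  module _ (acyclic : Acyclic G) where

    arc+walk⇒UCycle : ∀ {a b rest} → (a , b) ∉ rest → (∀ {u v} → (u , v) ∈ (a , b) ∷ rest → Edge G u v) →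
                      Star (Joins rest) a b → UCycle G
    arc+walk⇒UCycle {a} {b} {rest} ab∉ arc s with Star⇒path _≟_ s
    ... | [] , _ , _ , refl = ⊥-elim (acyclic a [ arc (here refl) ])
    ... | c ∷ [] , j ∷ [-] , _ , refl = ⊥-elim (parallel j)
      where
      parallel : Joins rest a c → ⊥
      parallel (inj₁ ac∈) = ab∉ ac∈
      parallel (inj₂ ca∈) = acyclic a (arc (here refl) ∷ [ arc (there ca∈) ])
    ... | c ∷ d ∷ xs , l , u , e = a , c ∷ d ∷ xs , s≤s (s≤s z≤n) , u ,
          Linked-∷ʳ a (c ∷ d ∷ xs) a (Linked.map UAdj-rest l)
            (subst (λ w → UAdj G w a) (sym e) (inj₂ (arc (here refl))))
      where
      UAdj-rest : ∀ {u v} → Joins rest u v → UAdj G u v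
      UAdj-rest (inj₁ m) = inj₁ (arc (there m))
      UAdj-rest (inj₂ m) = inj₂ (arc (there m))

    redundant⇒UCycle : redundant arcList ≢ 0 → UCycle G
    redundant⇒UCycle r≢0 with redundant⇒split arcList r≢0
    ... | pre , rest , a , b , split , la≡lb =
      arc+walk⇒UCycle (Unique[x∷xs]⇒x∉xs (proj₁ (proj₂ (Unique-++⁻ pre (subst Unique split arcList-Unique)))))
        (λ m → ∈-arcList⁻ (subst (_ ∈_) (sym split) (∈-++⁺ʳ pre m)))
        (label≡⇒Star rest a b la≡lb)

  module _ (connected : Connected G) (z₀ : V) where

    classes-arcList : classes (label arcList) ≡ 1
    classes-arcList = trans (count-cong λ x → cong (λ w → does (w ≟ x)) (label≡ x)) (count-≟ (label arcList z₀))
      where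
      label≡ : ∀ x → label arcList x ≡ label arcList z₀
      label≡ x = Star⇒label≡ arcList UAdj⇒Joins (connected x z₀)

    arcs+1≡n+redundant : arcs + 1 ≡ n G + redundant arcList
    arcs+1≡n+redundant = begin
      arcs + 1                                   ≡⟨ +-comm arcs 1 ⟩
      1 + arcs                                   ≡⟨ cong₂ _+_ classes-arcList length-arcList ⟨
      classes (label arcList) + length arcList   ≡⟨ classes+length arcList ⟩
      n G + redundant arcList                    ∎
      where open ≡-Reasoning

  Arboreal⇔arcs+1≡n : Acyclic G → Connected G → V → Arboreal G ⇔ (arcs + 1 ≡ n G)
  Arboreal⇔arcs+1≡n acyclic connected z₀ = mk⇔
    (λ (_ , ¬uc) → trans (arcs+1≡n+redundant connected z₀)
                         (trans (cong (n G +_) (redundant≡0 ¬uc)) (+-identityʳ (n G))))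
    (λ e → connected , λ uc → WalkCycle⇒redundant (UCycle⇒WalkCycle uc)
             (+-cancelˡ-≡ (n G) _ 0 (trans (sym (arcs+1≡n+redundant connected z₀))
                                           (trans e (sym (+-identityʳ (n G)))))))
    where
    redundant≡0 : ¬ UCycle G → redundant arcList ≡ 0
    redundant≡0 ¬uc = decidable-stable (redundant arcList ℕ.≟ 0) (¬uc ∘ redundant⇒UCycle acyclic)

module Descent {A : Set} {_<_ : A → A → Set} (wf : WellFounded _<_) {Step : A → A → Set}
               (step? : ∀ x → Dec (∃ (Step x))) (step-< : ∀ {x y} → Step x y → y < x) where

  terminal : ∀ {P : A → Set} → (∀ {x y} → P x → Step x y → P y) →
             ∀ {x} → P x → ∃ λ t → P t × ∀ y → ¬ Step t y
  terminal {P} P-step {x} px = go x (wf x) px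
    where
    go : ∀ x → Acc _<_ x → P x → ∃ λ t → P t × ∀ y → ¬ Step t y
    go x (acc rs) px with step? x
    ... | yes (y , s) = go y (rs (step-< s)) (P-step px s)
    ... | no ¬s       = x , px , λ y s → ¬s (y , s)

module Reachability (G : Digraph) (acyclic : Acyclic G) where

  Reach⁺-trans : ∀ {x y z} → Reach⁺ G x y → Reach⁺ G y z → Reach⁺ G x z
  Reach⁺-trans [ e ]    s = e ∷ s
  Reach⁺-trans (e ∷ r) s = e ∷ Reach⁺-trans r s

  Reach⁺-isStrictPartialOrder : IsStrictPartialOrder _≡_ (Reach⁺ G)
  Reach⁺-isStrictPartialOrder = record
    { isEquivalence = isEquivalence
    ; irrefl        = λ { refl → acyclic _ }
    ; trans         = Reach⁺-trans
    ; <-resp-≈      = resp₂ (Reach⁺ G)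
    }

  Reach⁺-wellFounded : WellFounded (Reach⁺ G)
  Reach⁺-wellFounded = spo-wellFounded Reach⁺-isStrictPartialOrder

  Reach⁺-flip-wellFounded : WellFounded (flip (Reach⁺ G))
  Reach⁺-flip-wellFounded = spo-wellFounded (Flip.isStrictPartialOrder Reach⁺-isStrictPartialOrder)

  Linked⇒Reach⁺ : ∀ a xs t x → Linked (Edge G) (a ∷ xs ++ t ∷ []) → x ∈ a ∷ xs → Reach⁺ G x t
  Linked⇒Reach⁺ a []       t x (e ∷ _) (here refl) = [ e ]
  Linked⇒Reach⁺ a (c ∷ xs) t x (e ∷ l) (here refl) = e ∷ Linked⇒Reach⁺ c xs t c l (here refl)
  Linked⇒Reach⁺ a (c ∷ xs) t x (e ∷ l) (there x∈)  = Linked⇒Reach⁺ c xs t x l x∈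

module AltCycle⇒WalkCycle (G : Digraph) (acyclic : Acyclic G) {m : ℕ} (alt : AltCycle G m) where

  open Skeleton G
  open Reachability G acyclic
  open AltCycle alt
  open import Data.List.Membership.DecPropositional (_≟_ {n G}) using (_∈?_)

  leftPath rightPath : Fin (suc m) → List V
  leftPath  i = pathVs G (v i) (midL i) (h i)
  rightPath i = pathVs G (v (next i)) (midR i) (h i)

  OnPath : Fin (suc m) → Fin (suc m) → Set
  OnPath i j = j ≢ i × (h i ∈ leftPath j ⊎ h i ∈ rightPath j)

  OnPath⇒Reach⁺ : ∀ {i j} → OnPath i j → Reach⁺ G (h i) (h j)
  OnPath⇒Reach⁺ {i} {j} (j≢i , inj₁ hᵢ∈) with ∈-++⁻ (v j ∷ midL j) hᵢ∈
  ... | inj₁ hᵢ∈′       = Linked⇒Reach⁺ (v j) (midL j) (h j) (h i) (proj₁ (pathL j)) hᵢ∈′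
  ... | inj₂ (here e)   = ⊥-elim (j≢i (sym (h-inj e)))
  OnPath⇒Reach⁺ {i} {j} (j≢i , inj₂ hᵢ∈) with ∈-++⁻ (v (next j) ∷ midR j) hᵢ∈
  ... | inj₁ hᵢ∈′       = Linked⇒Reach⁺ (v (next j)) (midR j) (h j) (h i) (proj₁ (pathR j)) hᵢ∈′
  ... | inj₂ (here e)   = ⊥-elim (j≢i (sym (h-inj e)))

  topmost : ∃ λ i → ∀ j → ¬ OnPath i j
  topmost with terminal (λ _ _ → tt) {zero} tt
    where open Descent (On.wellFounded h Reach⁺-flip-wellFounded)
                       (λ i → any? λ j → ¬? (j ≟ i) ×-dec ((h i ∈? leftPath j) ⊎-dec (h i ∈? rightPath j)))
                       OnPath⇒Reach⁺
  ... | i , _ , ¬on = i , ¬on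

  i₀ : Fin (suc m)
  i₀ = proj₁ topmost

  z : V
  z = h i₀

  Linked⇒Star-Avoid : ∀ a xs → Linked (Edge G) (a ∷ xs) → z ∉ a ∷ xs → Star (Avoid z) a (lastOf a xs)
  Linked⇒Star-Avoid a xs l z∉ =
    Linked⇒Star a xs (Linked.map (λ (e , p , q) → inj₁ e , p , q)
      (Linked-pointwise a xs l (λ w w∈ w≡z → z∉ (subst (_∈ a ∷ xs) w≡z w∈))))

  around-segment : ∀ j → j ≢ i₀ → Star (Avoid z) (v j) (v (next j))
  around-segment j j≢i₀ =
    down (v j) (midL j) (pathL j) (λ z∈ → proj₂ topmost j (j≢i₀ , inj₁ z∈)) ◅◅
    Star.reverse Avoid-sym (down (v (next j)) (midR j) (pathR j) (λ z∈ → proj₂ topmost j (j≢i₀ , inj₂ z∈)))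
    where
    down : ∀ u mid → DPath G u mid (h j) → z ∉ pathVs G u mid (h j) → Star (Avoid z) u (h j)
    down u mid p z∉ =
      subst (Star (Avoid z) u) (lastOf-∷ʳ u mid (h j)) (Linked⇒Star-Avoid u (mid ++ h j ∷ []) (proj₁ p) z∉)

  a b : V
  a = lastOf (v i₀) (midL i₀)
  b = lastOf (v (next i₀)) (midR i₀)

  z∉left : z ∉ v i₀ ∷ midL i₀
  z∉left z∈ = proj₂ (proj₂ (Unique-++⁻ (v i₀ ∷ midL i₀) (proj₂ (pathL i₀)))) (z∈ , here refl)

  z∉right : z ∉ v (next i₀) ∷ midR i₀
  z∉right z∈ = proj₂ (proj₂ (Unique-++⁻ (v (next i₀) ∷ midR i₀) (proj₂ (pathR i₀)))) (z∈ , here refl)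

  a≢b : a ≢ b
  a≢b a≡b = go (midL i₀) (midR i₀) refl refl
    where
    go : ∀ xs ys → midL i₀ ≡ xs → midR i₀ ≡ ys → ⊥
    go [] [] eqL eqR = distinct i₀ (begin
      leftPath i₀                    ≡⟨ cong (λ l → pathVs G (v i₀) l (h i₀)) eqL ⟩
      v i₀ ∷ h i₀ ∷ []               ≡⟨ cong (λ x → x ∷ h i₀ ∷ []) v≡v ⟩
      v (next i₀) ∷ h i₀ ∷ []        ≡⟨ cong (λ l → pathVs G (v (next i₀)) l (h i₀)) eqR ⟨
      rightPath i₀                   ∎)
      where
      open ≡-Reasoning
      v≡v : v i₀ ≡ v (next i₀)
      v≡v = trans (cong (lastOf (v i₀)) (sym eqL)) (trans a≡b (cong (lastOf (v (next i₀))) eqR))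
    go (c ∷ xs) _ eqL _ =
      proj₁ (disjoint i₀) a a∈midL (subst (_∈ rightPath i₀) (sym a≡b) (∈-++⁺ˡ (lastOf-∈ _ (midR i₀))))
      where
      a∈midL : a ∈ midL i₀
      a∈midL = subst (λ l → lastOf (v i₀) l ∈ l) (sym eqL) (lastOf-∈ c xs)
    go [] (c ∷ ys) _ eqR =
      proj₂ (disjoint i₀) b b∈midR (subst (_∈ leftPath i₀) a≡b (∈-++⁺ˡ (lastOf-∈ _ (midL i₀))))
      where
      b∈midR : b ∈ midR i₀
      b∈midR = subst (λ l → lastOf (v (next i₀)) l ∈ l) (sym eqR) (lastOf-∈ c ys)

  cycleThroughTop : WalkCycle
  cycleThroughTop = walkCycle z a b
    (inj₂ (Linked-last (v i₀) (midL i₀) z (proj₁ (pathL i₀))))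
    (inj₂ (Linked-last (v (next i₀)) (midR i₀) z (proj₁ (pathR i₀))))
    a≢b
    (Star.reverse Avoid-sym (Linked⇒Star-Avoid (v i₀) (midL i₀) (Linked-init _ _ _ (proj₁ (pathL i₀))) z∉left) ◅◅
     Star.reverse Avoid-sym (Star-around v i₀ around-segment) ◅◅
     Linked⇒Star-Avoid (v (next i₀)) (midR i₀) (Linked-init _ _ _ (proj₁ (pathR i₀))) z∉right)

module UCycle⇒AltCycle (G : Digraph) (acyclic : Acyclic G) where

  open Skeleton G
  open Reachability G acyclic
  open import Data.List.Membership.DecPropositional (_≟_ {n G}) using (_∈?_)

  source : ∀ {cs x} → x ∈ cs → ∃ λ s → s ∈ cs × ∀ w → w ∈ cs → ¬ Edge G w s
  source {cs} x∈ with terminal (λ _ (y∈ , _) → y∈) x∈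
    where open Descent Reach⁺-wellFounded (λ x → any? λ y → (y ∈? cs) ×-dec (adj G y x Bool.≟ true))
                                          (λ (_ , e) → [ e ])
  ... | s , s∈ , none = s , s∈ , λ w w∈ e → none w (w∈ , e)

  UCycleAt : V → List V → Set
  UCycleAt x ys = 2 ≤ length ys × Unique (x ∷ ys) × Linked (UAdj G) (x ∷ ys ++ x ∷ [])

  rotate : ∀ {x ys s} → UCycleAt x ys → s ∈ x ∷ ys →
           ∃ λ ys′ → UCycleAt s ys′ × (∀ {w} → w ∈ s ∷ ys′ → w ∈ x ∷ ys)
  rotate {ys = ys} c (here refl) = ys , c , id
  rotate {x} {ys} {s} (len , u , l) (there s∈) with ∈-∃++ s∈
  ... | p , q , refl =
    q ++ x ∷ p , (len′ , Unique-++-comm (x ∷ p) (s ∷ q) u , l′) , ∈-++-comm (s ∷ q) (x ∷ p)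
    where
    len′ : 2 ≤ length (q ++ x ∷ p)
    len′ = subst (2 ≤_) (begin
      length (p ++ s ∷ q)        ≡⟨ length-++ p ⟩
      length p + suc (length q)  ≡⟨ +-suc (length p) (length q) ⟩
      suc (length p + length q)  ≡⟨ cong suc (+-comm (length p) (length q)) ⟩
      suc (length q + length p)  ≡⟨ +-suc (length q) (length p) ⟨
      length q + suc (length p)  ≡⟨ length-++ q ⟨
      length (q ++ x ∷ p)        ∎) len
      where open ≡-Reasoning
    halves : Linked (UAdj G) (x ∷ p ++ s ∷ []) × Linked (UAdj G) (s ∷ q ++ x ∷ [])
    halves = Linked-split (x ∷ p) (subst (λ t → Linked (UAdj G) (x ∷ t)) (++-assoc p (s ∷ q) (x ∷ [])) l)
    l′ : Linked (UAdj G) (s ∷ (q ++ x ∷ p) ++ s ∷ [])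
    l′ = subst (λ t → Linked (UAdj G) (s ∷ t)) (sym (++-assoc q (x ∷ p) (s ∷ [])))
               (Linked-join (s ∷ q) (proj₂ halves) (proj₁ halves))

  module _ {P Q : V → V → Set} where

    MaximalRun : V → V → List V → Set
    MaximalRun a b xs = ∃ λ body → ∃ λ end → ∃ λ rest →
      b ∷ xs ≡ body ++ end ∷ rest × Linked P (a ∷ body ++ end ∷ []) ×
      (rest ≡ [] ⊎ ∃₂ λ c rest′ → rest ≡ c ∷ rest′ × Q end c) ×
      Linked (λ u w → P u w ⊎ Q u w) (end ∷ rest)

    maximalRun : ∀ a b xs → P a b → Linked (λ u w → P u w ⊎ Q u w) (b ∷ xs) → MaximalRun a b xs
    maximalRun a b []       p [-]            = [] , b , [] , refl , p ∷ [-] , inj₁ refl , [-]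
    maximalRun a b (c ∷ xs) p (inj₂ q ∷ l)  =
      [] , b , c ∷ xs , refl , p ∷ [-] , inj₂ (c , xs , refl , q) , inj₂ q ∷ l
    maximalRun a b (c ∷ xs) p (inj₁ p′ ∷ l) with maximalRun b c xs p′ l
    ... | body , end , rest , eq , run , stop , l′ = b ∷ body , end , rest , cong (b ∷_) eq , p ∷ run , stop , l′

  record Segment : Set where
    constructor segment
    field
      valley    : V
      rise      : List V
      peak      : V
      fall      : List V
      valley⁺   : V
      rising    : Linked (Edge G) (valley ∷ rise ++ peak ∷ [])
      falling   : Linked (flip (Edge G)) (peak ∷ fall ++ valley⁺ ∷ [])
  open Segment

  segmentVs : Segment → List V
  segmentVs g = valley g ∷ rise g ++ peak g ∷ fall g

  concatSegments : List Segment → List V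
  concatSegments []       = []
  concatSegments (g ∷ gs) = segmentVs g ++ concatSegments gs

  data Chain (s : V) : List Segment → Set where
    [_]  : ∀ {g} → valley⁺ g ≡ s → Chain s (g ∷ [])
    _∷_  : ∀ {g g′ gs} → valley⁺ g ≡ valley g′ → Chain s (g′ ∷ gs) → Chain s (g ∷ g′ ∷ gs)

  length-after : ∀ {zs ps} {a : V} {qs} → zs ≡ ps ++ a ∷ qs → length qs < length zs
  length-after {ps = ps} {a} {qs} refl = subst (length qs <_) (sym (length-++ ps)) (m≤n+m (suc (length qs)) (length ps))

  Segmentation : V → V → List V → Set
  Segmentation s v xs = ∃₂ λ g gs → valley g ≡ v × concatSegments (g ∷ gs) ≡ v ∷ xs × Chain s (g ∷ gs)

  segmentation : ∀ fuel s v y xs → length xs < fuel → Edge G v y → Linked (UAdj G) (y ∷ xs) →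
                 Edge G s (lastOf y xs) → Segmentation s v (y ∷ xs)
  segmentation (suc fuel) s v y xs xs<fuel vy l s→last with maximalRun v y xs vy l
  ... | rise , pk , .[] , eq₁ , up , inj₁ refl , _ =
    segment v rise pk [] s up (s→pk ∷ [-]) , [] , refl , trans (++-identityʳ _) (cong (v ∷_) (sym eq₁)) , [ refl ]
    where
    s→pk : Edge G s pk
    s→pk = subst (Edge G s) (lastOf-≡-++ y xs rise pk [] eq₁) s→last
  ... | rise , pk , .(c ∷ rest) , eq₁ , up , inj₂ (c , rest , refl , c→pk) , l₁
      with maximalRun pk c rest c→pk (Linked.map Sum.swap (Linked.tail l₁))
  ...   | fall , w , .[] , eq₂ , down , inj₁ refl , _ =
    segment v rise pk (fall ++ w ∷ []) s up down′ , [] , refl , covers , [ refl ]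
    where
    s→w : Edge G s w
    s→w = subst (Edge G s)
      (trans (lastOf-≡-++ y xs rise pk (c ∷ rest) eq₁) (lastOf-≡-++ c rest fall w [] eq₂)) s→last
    down′ : Linked (flip (Edge G)) (pk ∷ (fall ++ w ∷ []) ++ s ∷ [])
    down′ = Linked-∷ʳ pk (fall ++ w ∷ []) s down (subst (Edge G s) (sym (lastOf-∷ʳ pk fall w)) s→w)
    covers : (v ∷ rise ++ pk ∷ fall ++ w ∷ []) ++ [] ≡ v ∷ y ∷ xs
    covers = trans (++-identityʳ _) (cong (v ∷_) (sym (trans eq₁ (cong (λ t → rise ++ pk ∷ t) eq₂))))
  ...   | fall , w , .(d ∷ rest′) , eq₂ , down , inj₂ (d , rest′ , refl , w→d) , l₂
        with segmentation fuel s w d rest′ shorter w→d (Linked.map Sum.swap (Linked.tail l₂)) s→last′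
    where
    shorter : length rest′ < fuel
    shorter = <-≤-trans (<-trans (s<s⁻¹ (length-after eq₂)) (s<s⁻¹ (length-after eq₁))) (≤-pred xs<fuel)
    s→last′ : Edge G s (lastOf d rest′)
    s→last′ = subst (Edge G s)
      (trans (lastOf-≡-++ y xs rise pk (c ∷ rest) eq₁) (lastOf-≡-++ c rest fall w (d ∷ rest′) eq₂)) s→last
  ...     | g₁ , gs , refl , covers₁ , chain =
    segment v rise pk fall w up down , g₁ ∷ gs , refl , covers , refl ∷ chain
    where
    covers : (v ∷ rise ++ pk ∷ fall) ++ concatSegments (g₁ ∷ gs) ≡ v ∷ y ∷ xs
    covers = trans (cong ((v ∷ rise ++ pk ∷ fall) ++_) covers₁)
      (cong (v ∷_) (trans (++-assoc rise (pk ∷ fall) (w ∷ d ∷ rest′))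
                          (sym (trans eq₁ (cong (λ t → rise ++ pk ∷ t) eq₂)))))

  ∈-concatSegments : ∀ gs j {x} → x ∈ segmentVs (lookup gs j) → x ∈ concatSegments gs
  ∈-concatSegments (g ∷ gs) zero    x∈ = ∈-++⁺ˡ x∈
  ∈-concatSegments (g ∷ gs) (suc j) x∈ = ∈-++⁺ʳ (segmentVs g) (∈-concatSegments gs j x∈)

  segment-index-unique : ∀ gs → Unique (concatSegments gs) →
                         ∀ i j {x} → x ∈ segmentVs (lookup gs i) → x ∈ segmentVs (lookup gs j) → i ≡ j
  segment-index-unique (g ∷ gs) u zero    zero    _   _   = refl
  segment-index-unique (g ∷ gs) u zero    (suc j) x∈ᵢ x∈ⱼ =
    ⊥-elim (proj₂ (proj₂ (Unique-++⁻ (segmentVs g) u)) (x∈ᵢ , ∈-concatSegments gs j x∈ⱼ))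
  segment-index-unique (g ∷ gs) u (suc i) zero    x∈ᵢ x∈ⱼ =
    ⊥-elim (proj₂ (proj₂ (Unique-++⁻ (segmentVs g) u)) (x∈ⱼ , ∈-concatSegments gs i x∈ᵢ))
  segment-index-unique (g ∷ gs) u (suc i) (suc j) x∈ᵢ x∈ⱼ =
    cong suc (segment-index-unique gs (proj₁ (proj₂ (Unique-++⁻ (segmentVs g) u))) i j x∈ᵢ x∈ⱼ)

  segment-Unique : ∀ gs i → Unique (concatSegments gs) → Unique (segmentVs (lookup gs i))
  segment-Unique (g ∷ gs) zero    u = proj₁ (Unique-++⁻ (segmentVs g) u)
  segment-Unique (g ∷ gs) (suc i) u = segment-Unique gs i (proj₁ (proj₂ (Unique-++⁻ (segmentVs g) u)))

  Chain-step : ∀ {s g gs} → Chain s (g ∷ gs) → ∀ (j : Fin (length gs)) →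
               valley⁺ (lookup (g ∷ gs) (inject₁ j)) ≡ valley (lookup (g ∷ gs) (suc j))
  Chain-step (e ∷ _)     zero    = e
  Chain-step (_ ∷ chain) (suc j) = Chain-step chain j

  Chain-last : ∀ {s g gs} → Chain s (g ∷ gs) → valley⁺ (lookup (g ∷ gs) (fromℕ (length gs))) ≡ s
  Chain-last [ e ]       = e
  Chain-last (_ ∷ chain) = Chain-last chain

  peak∈ : ∀ g → peak g ∈ segmentVs g
  peak∈ g = there (∈-++⁺ʳ (rise g) (here refl))

  module SegmentFacts (g : Segment) (u : Unique (segmentVs g)) where

    private
      split : Unique (rise g) × Unique (peak g ∷ fall g) × Disjoint (rise g) (peak g ∷ fall g)
      split = Unique-++⁻ (rise g) (Unique-tail u)

    valley∉rise : valley g ∉ rise g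
    valley∉rise = Unique[x∷xs]⇒x∉xs u ∘ ∈-++⁺ˡ

    valley≢peak : valley g ≢ peak g
    valley≢peak e = Unique[x∷xs]⇒x∉xs u (∈-++⁺ʳ (rise g) (here e))

    valley∉fall : valley g ∉ fall g
    valley∉fall = Unique[x∷xs]⇒x∉xs u ∘ ∈-++⁺ʳ (rise g) ∘ there

    peak∉rise : peak g ∉ rise g
    peak∉rise p∈ = proj₂ (proj₂ split) (p∈ , here refl)

    peak∉fall : peak g ∉ fall g
    peak∉fall = Unique[x∷xs]⇒x∉xs (proj₁ (proj₂ split))

    rise#fall : Disjoint (rise g) (fall g)
    rise#fall (x∈r , x∈f) = proj₂ (proj₂ split) (x∈r , there x∈f)

    rise-Unique : Unique (rise g)
    rise-Unique = proj₁ split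

    fall-Unique : Unique (fall g)
    fall-Unique = Unique-tail (proj₁ (proj₂ split))

  single-segment : ∀ g gs (i : Fin (suc (length gs))) → next i ≡ i →
                   rise (lookup (g ∷ gs) i) ≡ [] → fall (lookup (g ∷ gs) i) ≡ [] →
                   length (concatSegments (g ∷ gs)) ≡ 2
  single-segment g []       zero _ rise≡[] fall≡[] rewrite rise≡[] | fall≡[] = refl
  single-segment g (_ ∷ gs) i next≡i _ _ = ⊥-elim (next-≢ (length gs) i next≡i)

  first-of-fall : ∀ g → ∃ λ b → Edge G b (peak g) × (b ∈ fall g ⊎ (fall g ≡ [] × b ≡ valley⁺ g))
  first-of-fall (segment _ _ pk []       w _ (e ∷ _)) = w , e , inj₂ (refl , refl)
  first-of-fall (segment _ _ pk (c ∷ fl) w _ (e ∷ _)) = c , e , inj₁ (here refl)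

  module FromSegments {s ys} (cycle : UCycleAt s ys) {g₀ gs} (valley₀ : valley g₀ ≡ s)
                      (covers : concatSegments (g₀ ∷ gs) ≡ s ∷ ys) (chain : Chain s (g₀ ∷ gs)) where

    M : ℕ
    M = length gs

    seg : Fin (suc M) → Segment
    seg = lookup (g₀ ∷ gs)

    index-unique : ∀ i j {x} → x ∈ segmentVs (seg i) → x ∈ segmentVs (seg j) → i ≡ j
    index-unique = segment-index-unique (g₀ ∷ gs) (subst Unique (sym covers) (proj₁ (proj₂ cycle)))

    module Facts (i : Fin (suc M)) =
      SegmentFacts (seg i) (segment-Unique (g₀ ∷ gs) i (subst Unique (sym covers) (proj₁ (proj₂ cycle))))

    valley⁺≡valley-next : ∀ i → valley⁺ (seg i) ≡ valley (seg (next i))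
    valley⁺≡valley-next i with next-view M i
    ... | inj₁ (refl , next≡0)    = trans (Chain-last chain) (trans (sym valley₀) (cong (valley ∘ seg) (sym next≡0)))
    ... | inj₂ (j , refl , next≡) = trans (Chain-step chain j) (cong (valley ∘ seg) (sym next≡))

    valley⁺∈⇒valley : ∀ i {x} → x ∈ segmentVs (seg i) → x ≡ valley⁺ (seg i) → x ≡ valley (seg i)
    valley⁺∈⇒valley i {x} x∈ x≡ = trans (trans x≡ (valley⁺≡valley-next i)) (cong (valley ∘ seg) (sym i≡next))
      where
      i≡next : i ≡ next i
      i≡next = index-unique i (next i) x∈ (here (trans x≡ (valley⁺≡valley-next i)))

    length≢2 : ∀ {k} → 2 ≤ k → suc k ≢ 2
    length≢2 (s≤s ()) refl

    nondegenerate : ∀ i → rise (seg i) ≡ [] → fall (seg i) ≡ [] → valley (seg i) ≢ valley (seg (next i))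
    nondegenerate i rise≡[] fall≡[] v≡v =
      length≢2 (proj₁ cycle) (trans (cong length (sym covers))
        (single-segment g₀ gs i (sym (index-unique i (next i) (here refl) (here v≡v))) rise≡[] fall≡[]))

    valley′ peak′ : Fin (suc M) → V
    valley′ = valley ∘ seg
    peak′   = peak ∘ seg

    rise′ fall′ : Fin (suc M) → List V
    rise′ = rise ∘ seg
    fall′ = reverse ∘ fall ∘ seg

    valley-injective : ∀ {i j} → valley′ i ≡ valley′ j → i ≡ j
    valley-injective e = index-unique _ _ (here refl) (here e)

    peak-injective : ∀ {i j} → peak′ i ≡ peak′ j → i ≡ j
    peak-injective {i} {j} e = index-unique i j (peak∈ (seg i)) (subst (_∈ segmentVs (seg j)) (sym e) (peak∈ (seg j)))

    valley≢peak : ∀ i j → valley′ i ≢ peak′ j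
    valley≢peak i j e with index-unique i j (here refl) (subst (_∈ segmentVs (seg j)) (sym e) (peak∈ (seg j)))
    ... | refl = Facts.valley≢peak i e

    valley⁺∉fall : ∀ i → valley⁺ (seg i) ∉ fall (seg i)
    valley⁺∉fall i x∈ = Facts.valley∉fall i
      (subst (_∈ fall (seg i)) (valley⁺∈⇒valley i (there (∈-++⁺ʳ (rise′ i) (there x∈))) refl) x∈)

    peak≢valley⁺ : ∀ i → peak′ i ≢ valley⁺ (seg i)
    peak≢valley⁺ i e = Facts.valley≢peak i (sym (valley⁺∈⇒valley i (peak∈ (seg i)) e))

    leftPath : ∀ i → DPath G (valley′ i) (rise′ i) (peak′ i)
    leftPath i = rising (seg i) ,
      Unique-path (Facts.valley∉rise i) (Facts.valley≢peak i) (Facts.peak∉rise i) (Facts.rise-Unique i)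

    rightPath : ∀ i → DPath G (valley′ (next i)) (fall′ i) (peak′ i)
    rightPath i = subst (λ w → DPath G w (fall′ i) (peak′ i)) (valley⁺≡valley-next i)
      (Linked-reverse (peak′ i) (fall (seg i)) (valley⁺ (seg i)) (falling (seg i)) ,
       Unique-path (valley⁺∉fall i ∘ Any.reverse⁻) (peak≢valley⁺ i ∘ sym) (Facts.peak∉fall i ∘ Any.reverse⁻)
                   (Unique-reverse _ (Facts.fall-Unique i)))

    disjoint : ∀ i → InternallyDisjoint G (valley′ i) (rise′ i) (peak′ i) (valley′ (next i)) (fall′ i) (peak′ i)
    disjoint i = rise∉right , fall∉left
      where
      rise∉right : ∀ x → x ∈ rise′ i → x ∉ pathVs G (valley′ (next i)) (fall′ i) (peak′ i)
      rise∉right x x∈ (here x≡) = Facts.valley∉rise i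
        (subst (_∈ rise′ i) (valley⁺∈⇒valley i (there (∈-++⁺ˡ x∈)) (trans x≡ (sym (valley⁺≡valley-next i)))) x∈)
      rise∉right x x∈ (there x∈′) with ∈-++⁻ (fall′ i) x∈′
      ... | inj₁ x∈f         = Facts.rise#fall i (x∈ , Any.reverse⁻ x∈f)
      ... | inj₂ (here refl) = Facts.peak∉rise i x∈
      fall∉left : ∀ x → x ∈ fall′ i → x ∉ pathVs G (valley′ i) (rise′ i) (peak′ i)
      fall∉left x x∈ (here refl) = Facts.valley∉fall i (Any.reverse⁻ x∈)
      fall∉left x x∈ (there x∈′) with ∈-++⁻ (rise′ i) x∈′
      ... | inj₁ x∈r         = Facts.rise#fall i (x∈r , Any.reverse⁻ x∈)
      ... | inj₂ (here refl) = Facts.peak∉fall i (Any.reverse⁻ x∈)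

    distinct : ∀ i → pathVs G (valley′ i) (rise′ i) (peak′ i) ≢ pathVs G (valley′ (next i)) (fall′ i) (peak′ i)
    distinct i e
      with ≡reverse⇒[] (rise′ i) (fall (seg i)) (∷ʳ-injectiveˡ (rise′ i) (fall′ i) (proj₂ (∷-injective e)))
                       (Facts.rise#fall i)
    ... | rise≡[] , fall≡[] = nondegenerate i rise≡[] fall≡[] (proj₁ (∷-injective e))

    last-of-rise≢ : ∀ i {b} → b ∈ fall (seg i) ⊎ (fall (seg i) ≡ [] × b ≡ valley⁺ (seg i)) →
                    lastOf (valley′ i) (rise′ i) ≢ b
    last-of-rise≢ i b-where a≡b with b-where | lastOf-∈ (valley′ i) (rise′ i)
    ... | inj₁ b∈ | here a≡v  = Facts.valley∉fall i (subst (_∈ fall (seg i)) (trans (sym a≡b) a≡v) b∈)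
    ... | inj₁ b∈ | there a∈r = Facts.rise#fall i (a∈r , subst (_∈ fall (seg i)) (sym a≡b) b∈)
    ... | inj₂ (fall≡[] , b≡v⁺) | a∈ =
      nondegenerate i (lastOf-self (rise′ i) (Facts.valley∉rise i) a≡v) fall≡[]
        (trans (sym a≡v) (trans (trans a≡b b≡v⁺) (valley⁺≡valley-next i)))
      where
      a≡v : lastOf (valley′ i) (rise′ i) ≡ valley′ i
      a≡v = valley⁺∈⇒valley i (∈-++⁺ˡ a∈) (trans a≡b b≡v⁺)

    hybrid : ∀ i → Hybrid G (peak′ i)
    hybrid i with first-of-fall (seg i)
    ... | b , b→pk , b-where =
      count-≥2 (λ x → adj G x (peak′ i)) _ b (last-of-rise≢ i b-where)
               (Linked-last (valley′ i) (rise′ i) (peak′ i) (rising (seg i))) b→pk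

    altCycle : AltCycle G M
    altCycle = record
      { v = valley′ ; h = peak′ ; v-inj = valley-injective ; h-inj = peak-injective ; v≢h = valley≢peak
      ; hybrid = hybrid ; midL = rise′ ; midR = fall′ ; pathL = leftPath ; pathR = rightPath
      ; distinct = distinct ; disjoint = disjoint }

  out-arc : ∀ {u w} → UAdj G u w → ¬ Edge G w u → Edge G u w
  out-arc (inj₁ e)  _   = e
  out-arc (inj₂ e) ¬e = ⊥-elim (¬e e)

  UCycle⇒HasAltCycle : UCycle G → HasAltCycle G
  UCycle⇒HasAltCycle (x , ys , c) with source {x ∷ ys} (here refl)
  ... | s , s∈ , no-in with rotate c s∈
  ...   | [] , (() , _) , _
  ...   | y ∷ rest , c′@(_ , _ , l) , ⊆cycle
        with segmentation (suc (length rest)) s s y rest (n<1+n _) s→y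
                          (Linked.tail (Linked-init s (y ∷ rest) s l)) s→last
    where
    s→y : Edge G s y
    s→y = out-arc (Linked.head l) (no-in y (⊆cycle (there (here refl))))
    s→last : Edge G s (lastOf y rest)
    s→last = out-arc (UAdj-sym (Linked-last s (y ∷ rest) s l)) (no-in _ (⊆cycle (lastOf-∈ s (y ∷ rest))))
  ...     | g₀ , gs , valley₀ , covers , chain = length gs , FromSegments.altCycle c′ valley₀ covers chain

Arboreal⇔h̃+1≡r : ∀ G → Acyclic G → Connected G → Vtx G → Arboreal G ⇔ (h̃ G + 1 ≡ r G)
Arboreal⇔h̃+1≡r G acyclic connected z₀ =
  mk⇔ (from h̃⇔arcs ∘ to arboreal⇔arcs) (from arboreal⇔arcs ∘ to h̃⇔arcs)
  where
  open Skeleton G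
  open Equivalence
  arboreal⇔arcs : Arboreal G ⇔ (arcs + 1 ≡ n G)
  arboreal⇔arcs = Arboreal⇔arcs+1≡n acyclic connected z₀
  h̃⇔arcs : (h̃ G + 1 ≡ r G) ⇔ (arcs + 1 ≡ n G)
  h̃⇔arcs = h̃+1≡r⇔arcs+1≡n

Arboreal⇔¬HasAltCycle : ∀ G → Acyclic G → Connected G → Arboreal G ⇔ (¬ HasAltCycle G)
Arboreal⇔¬HasAltCycle G acyclic connected = mk⇔
  (λ (_ , ¬ucycle) (_ , alt) → ¬ucycle (WalkCycle⇒UCycle (AltCycle⇒WalkCycle.cycleThroughTop G acyclic alt)))
  (λ ¬alt → connected , ¬alt ∘ UCycle⇒AltCycle.UCycle⇒HasAltCycle G acyclic)
  where open Skeleton G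

proposition3p2 : (N : Digraph) → IsNetwork N →
    (Arboreal N ⇔ (h̃ N + 1 ≡ r N)) × (Arboreal N ⇔ (¬ HasAltCycle N))
proposition3p2 N net =
  Arboreal⇔h̃+1≡r N acyclic connected (count-≥1⇒Fin (isLeaf N) (≤-trans (s≤s z≤n) leaves≥2)) ,
  Arboreal⇔¬HasAltCycle N acyclic connected
  where open IsNetwork net
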